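{- For any two compositions $\alpha$ and $\beta$ of $N$, $|S_{\alpha\beta}(213)|=|S_{\alpha\beta}(123)|$.
   Context: A composition of $N$ is a finite sequence of nonnegative integers summing to $N$. For $\alpha=(\alpha_1,\ldots,\alpha_n)$, $\beta=(\beta_1,\ldots,\beta_m)$, $S_{\alpha\beta}$ is the set of generalized permutations of $\alpha\to\beta$: two-rowed arrays with top row $1^{\alpha_1}\cdots n^{\alpha_n}$ and bottom row $\tau_{11}\cdots\tau_{1\alpha_1}\cdots\tau_{n1}\cdots\tau_{n\alpha_n}$ with $\tau_{i1}\le\cdots\le\tau_{i\alpha_i}$ for each $i$ (the $i$-th block) and multiset of bottom entries $\{1^{\beta_1},\ldots,m^{\beta_m}\}$. For $\pi\in S_3$, $\tau$ avoids $\pi$ if there are no $1\le i_1<i_2<i_3\le n$ and $j_1,j_2,j_3$ such that $\tau_{i_sj_s}<\tau_{i_tj_t}$ iff $\pi_s<\pi_t$ for all $s,t$; $S_{\alpha\beta}(\pi)$ is the set of $\pi$-avoiding elements of $S_{\alpha\beta}$. -}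

module Defs where

open import Data.Nat using (ℕ)
open import Data.Fin as Fin using (Fin; zero; suc; _≟_)
open import Data.List using (List; length; map; concat; filter; lookup)
open import Data.Nat.ListAction using (sum)
open import Data.List.Membership.Propositional using (_∈_)
open import Data.List.Relation.Unary.All using (All)
open import Data.List.Relation.Unary.Linked using (Linked)
open import Data.Product using (Σ; ∃; _×_; _,_)
open import Data.Refinement using (Refinement)
open import Function.Bundles using (_⇔_)
open import Relation.Binary.PropositionalEquality using (_≡_)
open import Relation.Nullary using (¬_)

Composition : Set
Composition = List ℕ

IsCompositionOf : ℕ → Composition → Set
IsCompositionOf N α = sum α ≡ N

-- Bottom-row entries of a generalized permutation α → β lie in
-- {1,…,m}, m = length β; we encode them as Fin m (value j+1 ↦ j).
-- A candidate array τ is given by its list of blocks (block i is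
-- τ_{i1} … τ_{iα_i}).
Array : Composition → Set
Array β = List (List (Fin (length β)))

mult : ∀ {m} → Fin m → List (Fin m) → ℕ
mult j xs = length (filter (_≟ j) xs)

IsGenPerm : (α β : Composition) → Array β → Set
IsGenPerm α β τ =
    (map length τ ≡ α)
  × All (Linked Fin._≤_) τ
  × ((j : Fin (length β)) → mult j (concat τ) ≡ lookup β j)

Pattern : Set
Pattern = Fin 3 → ℕ

Contains : ∀ {m} → Pattern → List (List (Fin m)) → Set
Contains {m} π τ =
  Σ (Fin 3 → Fin (length τ)) λ i →
    (i zero Fin.< i (suc zero)) × (i (suc zero) Fin.< i (suc (suc zero))) ×
    Σ (Fin 3 → Fin m) λ x →
      ((s : Fin 3) → x s ∈ lookup τ (i s)) ×
      ((s t : Fin 3) → (x s Fin.< x t) ⇔ (π s Data.Nat.< π t))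
  where import Data.Nat

Avoids : ∀ {m} → Pattern → List (List (Fin m)) → Set
Avoids π τ = ¬ Contains π τ

S : (α β : Composition) → Pattern → Set
S α β π = Refinement (Array β) (λ τ → IsGenPerm α β τ × Avoids π τ)

p123 : Pattern
p123 zero = 1
p123 (suc zero) = 2
p123 (suc (suc zero)) = 3

p213 : Pattern
p213 zero = 2
p213 (suc zero) = 1
p213 (suc (suc zero)) = 3

module Submission where

-- Scan the blocks from right to left, keeping the largest entry t met so far. The entries of a
-- block below t are its low entries; only they can play the roles of 1 and 2 in an occurrence of
-- 123 or 213 (the 3 is to their right), so the high entries stay where they are. The array avoids
-- 123 iff, scanning from the right, each block's low entries are the smallest low entries not yet
-- used, and it avoids 213 iff they are the largest not yet used among those below the block's t.
-- Either arrangement is determined by the sorted list of all low entries and the block sizes and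
-- thresholds, and one is possible exactly when the other is (the thresholds only grow), so
-- redealing the low entries the other way is a bijection.

open import Defs
open import Data.Nat as ℕ using (ℕ; zero; suc; _+_; _∸_; _⊔_; _≤_; _<_; z≤n; s≤s)
import Data.Nat.Properties as ℕₚ
open import Data.Fin as F using (Fin; toℕ)
open import Data.Fin.Patterns using (0F; 1F; 2F)
import Data.Fin.Properties as Fₚ
open import Data.List as L using (List; []; _∷_; _++_; _∷ʳ_; length; concat; take; drop; takeWhile; dropWhile; filter; reverse; map; zipWith)
import Data.List.Properties as Lₚ
open import Data.List.Relation.Unary.All as All using (All; []; _∷_)
import Data.List.Relation.Unary.All.Properties as Allₚ
open import Data.List.Relation.Unary.AllPairs using (AllPairs; []; _∷_)
import Data.List.Relation.Unary.AllPairs.Properties as AllPairsₚ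
open import Data.List.Relation.Unary.Any using (here; there)
open import Data.List.Relation.Unary.Linked using (Linked)
import Data.List.Relation.Unary.Linked.Properties as Linkedₚ
open import Data.List.Membership.Propositional using (_∈_)
import Data.List.Membership.Propositional.Properties as ∈ₚ
open import Data.List.Relation.Binary.Permutation.Propositional
  using (_↭_; ↭-refl; ↭-sym; ↭-trans; ↭-reflexive; ↭-prep; ↭⇒↭ₛ; module PermutationReasoning)
open import Data.List.Relation.Binary.Permutation.Propositional.Properties
  using (filter-↭; ++-comm; shift; shifts; ++⁺ʳ; ++⁺ˡ; ++⁺; ∈-resp-↭; ↭-length; ↭-reverse; ↭-empty-inv)
open import Data.List.Relation.Binary.Pointwise using (Pointwise; []; _∷_)
open import Data.List.Relation.Binary.Equality.Propositional using (≋⇒≡)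
open import Data.List.Relation.Unary.Sorted.TotalOrder.Properties using (↗↭↗⇒≋)
import Data.List.Sort
open import Data.Product using (Σ; _×_; _,_; proj₁; proj₂)
open import Data.Sum using (_⊎_; inj₁; inj₂)
open import Data.Empty using (⊥; ⊥-elim)
open import Data.Unit using (⊤; tt)
open import Data.Irrelevant using ([_])
open import Data.Refinement using (_,_)
open import Data.Refinement.Properties using (value-injective)
open import Function.Base using (_∘_)
open import Function.Bundles using (_⇔_; mk⇔; Equivalence; _↔_; mk↔ₛ′)
open import Relation.Binary.Definitions using (tri<; tri≈; tri>)
open import Relation.Binary.PropositionalEquality using (_≡_; refl; sym; trans; cong; cong₂; subst; subst₂; module ≡-Reasoning)
open import Relation.Nullary using (¬_; yes; no)
open import Relation.Nullary.Decidable using (recompute)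
open import Relation.Unary using (Decidable)
open import Relation.Unary.Properties using (∁?)

module _ {A : Set} where

  take-++-≤ : ∀ k (xs : List A) {ys} → k ≤ length xs → take k (xs ++ ys) ≡ take k xs
  take-++-≤ zero    xs       _       = refl
  take-++-≤ (suc k) (x ∷ xs) (s≤s p) = cong (x ∷_) (take-++-≤ k xs p)

  drop-++-≤ : ∀ k (xs : List A) {ys} → k ≤ length xs → drop k (xs ++ ys) ≡ drop k xs ++ ys
  drop-++-≤ zero    xs       _       = refl
  drop-++-≤ (suc k) (x ∷ xs) (s≤s p) = drop-++-≤ k xs p

  take-length-++ : ∀ (xs : List A) {ys} → take (length xs) (xs ++ ys) ≡ xs
  take-length-++ []       = refl
  take-length-++ (x ∷ xs) = cong (x ∷_) (take-length-++ xs)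

  drop-length-++ : ∀ (xs : List A) {ys} → drop (length xs) (xs ++ ys) ≡ ys
  drop-length-++ []       = refl
  drop-length-++ (x ∷ xs) = drop-length-++ xs

  ∈-take⇒∈ : ∀ {x} k (xs : List A) → x ∈ take k xs → x ∈ xs
  ∈-take⇒∈ k xs p = subst (_ ∈_) (Lₚ.take++drop≡id k xs) (∈ₚ.∈-++⁺ˡ p)

  filter-++-filter-∁-↭ : ∀ {P : A → Set} (P? : Decidable P) xs → filter P? xs ++ filter (∁? P?) xs ↭ xs
  filter-++-filter-∁-↭ P? []       = ↭-refl
  filter-++-filter-∁-↭ P? (x ∷ xs) with P? x
  ... | yes _ = ↭-prep x (filter-++-filter-∁-↭ P? xs)
  ... | no  _ = ↭-trans (shift x (filter P? xs) (filter (∁? P?) xs)) (↭-prep x (filter-++-filter-∁-↭ P? xs))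

  all-reverse : ∀ {P : A → Set} xs → All P xs → All P (reverse xs)
  all-reverse xs ps = All.tabulate λ x∈ → All.lookup ps (∈-resp-↭ (↭-reverse xs) x∈)

  concat-∷ʳ : ∀ (xss : List (List A)) xs → concat (xss ∷ʳ xs) ≡ concat xss ++ xs
  concat-∷ʳ xss xs = trans (sym (Lₚ.concat-++ xss (xs ∷ []))) (cong (concat xss ++_) (Lₚ.++-identityʳ xs))

  reverse-++-∷ : ∀ (xss : List (List A)) xs yss → reverse (xss ++ xs ∷ yss) ≡ reverse yss ++ xs ∷ reverse xss
  reverse-++-∷ xss xs yss =
    trans (Lₚ.reverse-++ xss (xs ∷ yss))
          (trans (cong (_++ reverse xss) (Lₚ.unfold-reverse xs yss))
                 (Lₚ.++-assoc (reverse yss) (xs ∷ []) (reverse xss)))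

  ∈-concat-reverse : ∀ {x} (xss : List (List A)) → x ∈ concat xss → x ∈ concat (reverse xss)
  ∈-concat-reverse xss p with ∈ₚ.∈-concat⁻′ xss p
  ... | xs , x∈xs , xs∈xss = ∈ₚ.∈-concat⁺′ x∈xs (∈-resp-↭ (↭-sym (↭-reverse xss)) xs∈xss)

  concat-reverse-↭ : ∀ (xss : List (List A)) → concat (reverse xss) ↭ concat xss
  concat-reverse-↭ []         = ↭-refl
  concat-reverse-↭ (xs ∷ xss) =
    ↭-trans (↭-reflexive (trans (cong concat (Lₚ.unfold-reverse xs xss)) (concat-∷ʳ (reverse xss) xs)))
            (↭-trans (++⁺ʳ xs (concat-reverse-↭ xss)) (++-comm (concat xss) xs))

  concat-zipWith-++-↭ : ∀ (xss yss : List (List A)) → length xss ≡ length yss →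
                        concat (zipWith _++_ xss yss) ↭ concat xss ++ concat yss
  concat-zipWith-++-↭ []         []         _ = ↭-refl
  concat-zipWith-++-↭ (xs ∷ xss) (ys ∷ yss) e =
    ↭-trans (++⁺ˡ (xs ++ ys) (concat-zipWith-++-↭ xss yss (ℕₚ.suc-injective e)))
    (↭-trans (↭-reflexive (Lₚ.++-assoc xs ys _))
    (↭-trans (++⁺ˡ xs (shifts ys (concat xss))) (↭-reflexive (sym (Lₚ.++-assoc xs (concat xss) _)))))

module Blocks (m : ℕ) where

  open Data.List.Sort (Fₚ.≤-decTotalOrder m) using (sort; sort-↭; sort-↗)

  Ascending : List (Fin m) → Set
  Ascending = AllPairs F._≤_

  linked⇒ascending : ∀ {xs} → Linked F._≤_ xs → Ascending xs
  linked⇒ascending = Linkedₚ.Linked⇒AllPairs ℕₚ.≤-trans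

  ascending-sort : ∀ xs → Ascending (sort xs)
  ascending-sort xs = linked⇒ascending (sort-↗ xs)

  ascending-unique : ∀ {xs ys} → Ascending xs → Ascending ys → xs ↭ ys → xs ≡ ys
  ascending-unique xs↗ ys↗ xs↭ys =
    ≋⇒≡ (↗↭↗⇒≋ (Fₚ.≤-totalOrder m) (Linkedₚ.AllPairs⇒Linked xs↗) (Linkedₚ.AllPairs⇒Linked ys↗) (↭⇒↭ₛ xs↭ys))

  ascending-++⁻ : ∀ xs {ys} → Ascending (xs ++ ys) →
                  Ascending xs × Ascending ys × (∀ {x y} → x ∈ xs → y ∈ ys → x F.≤ y)
  ascending-++⁻ []       p          = [] , p , λ ()
  ascending-++⁻ (x ∷ xs) (px ∷ p) with ascending-++⁻ xs p
  ... | xs↗ , ys↗ , xs≤ys = Allₚ.++⁻ˡ xs px ∷ xs↗ , ys↗ , x∷xs≤ys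
    where
    x∷xs≤ys : ∀ {u v} → u ∈ x ∷ xs → v ∈ _ → u F.≤ v
    x∷xs≤ys (here refl) v∈ = All.lookup (Allₚ.++⁻ʳ xs px) v∈
    x∷xs≤ys (there u∈)  v∈ = xs≤ys u∈ v∈

  ascending-++⁺ : ∀ {xs ys} → Ascending xs → Ascending ys → (∀ {x y} → x ∈ xs → y ∈ ys → x F.≤ y) →
                  Ascending (xs ++ ys)
  ascending-++⁺ xs↗ ys↗ xs≤ys = AllPairsₚ.++⁺ xs↗ ys↗ (All.tabulate λ x∈ → All.tabulate λ y∈ → xs≤ys x∈ y∈)

  ascending-take-drop : ∀ k {xs} → Ascending xs →
    Ascending (take k xs) × Ascending (drop k xs) × (∀ {x y} → x ∈ take k xs → y ∈ drop k xs → x F.≤ y)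
  ascending-take-drop k {xs} xs↗ = ascending-++⁻ (take k xs) (subst Ascending (sym (Lₚ.take++drop≡id k xs)) xs↗)

  -- Splitting a sorted block at a threshold

  Below : ℕ → Fin m → Set
  Below T x = toℕ x < T

  -- Opaque: otherwise `with below? T x` would not abstract the unfolded test inside low and high.
  opaque
    below? : ∀ T → Decidable (Below T)
    below? T x = toℕ x ℕ.<? T

  low : ℕ → List (Fin m) → List (Fin m)
  low T = takeWhile (below? T)

  high : ℕ → List (Fin m) → List (Fin m)
  high T = dropWhile (below? T)

  low++high : ∀ T xs → xs ≡ low T xs ++ high T xs
  low++high T xs = sym (Lₚ.takeWhile++dropWhile (below? T) xs)

  low-below : ∀ T xs → All (Below T) (low T xs)
  low-below T = Allₚ.all-takeWhile (below? T)

  length-low≤ : ∀ T xs → length (low T xs) ≤ length xs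
  length-low≤ T xs = subst (λ ys → length (low T xs) ≤ length ys) (sym (low++high T xs))
                       (Lₚ.length-++-≤ˡ (low T xs))

  ≤length-low : ∀ {T} k xs → k ≤ length xs → All (Below T) (take k xs) → k ≤ length (low T xs)
  ≤length-low     zero    xs       _       _          = z≤n
  ≤length-low {T} (suc k) (x ∷ xs) (s≤s p) (x<T ∷ xs<T) with below? T x
  ... | yes _   = s≤s (≤length-low k xs p xs<T)
  ... | no  x≮T = ⊥-elim (x≮T x<T)

  take-low : ∀ {T} k xs → k ≤ length (low T xs) → take k xs ≡ take k (low T xs)
  take-low {T} k xs p = trans (cong (take k) (low++high T xs)) (take-++-≤ k (low T xs) p)

  drop-low : ∀ {T} k xs → k ≤ length (low T xs) → drop k xs ≡ drop k (low T xs) ++ high T xs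
  drop-low {T} k xs p = trans (cong (drop k) (low++high T xs)) (drop-++-≤ k (low T xs) p)

  low-++ : ∀ {T} xs ys → All (Below T) xs → low T (xs ++ ys) ≡ xs ++ low T ys
  low-++     []       ys _            = refl
  low-++ {T} (x ∷ xs) ys (x<T ∷ xs<T) with below? T x
  ... | yes _   = cong (x ∷_) (low-++ xs ys xs<T)
  ... | no  x≮T = ⊥-elim (x≮T x<T)

  high-++ : ∀ {T} xs ys → All (Below T) xs → high T (xs ++ ys) ≡ high T ys
  high-++     []       ys _            = refl
  high-++ {T} (x ∷ xs) ys (x<T ∷ xs<T) with below? T x
  ... | yes _   = high-++ xs ys xs<T
  ... | no  x≮T = ⊥-elim (x≮T x<T)

  low-high : ∀ T xs → low T (high T xs) ≡ []
  low-high T []       = refl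
  low-high T (x ∷ xs) with below? T x in eq
  ... | yes _ = low-high T xs
  ... | no  _ rewrite eq = refl

  high-high : ∀ T xs → high T (high T xs) ≡ high T xs
  high-high T []       = refl
  high-high T (x ∷ xs) with below? T x in eq
  ... | yes _ = high-high T xs
  ... | no  _ rewrite eq = refl

  low-ascending : ∀ T {xs} → Ascending xs → low T xs ≡ filter (below? T) xs
  low-ascending T {[]}     _          = refl
  low-ascending T {x ∷ xs} (x≤ ∷ xs↗) with below? T x
  ... | yes _   = cong (x ∷_) (low-ascending T xs↗)
  ... | no  x≮T = sym (Lₚ.filter-none (below? T) (All.map (λ x≤y y<T → x≮T (ℕₚ.≤-<-trans x≤y y<T)) x≤))

  high-ascending : ∀ T {xs} → Ascending xs → high T xs ≡ filter (∁? (below? T)) xs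
  high-ascending T {[]}     _          = refl
  high-ascending T {x ∷ xs} (x≤ ∷ xs↗) with below? T x
  ... | yes _   = high-ascending T xs↗
  ... | no  x≮T = cong (x ∷_) (sym (Lₚ.filter-all (∁? (below? T)) (All.map (λ x≤y y<T → x≮T (ℕₚ.≤-<-trans x≤y y<T)) x≤)))

  high-not-below : ∀ T {xs x} → Ascending xs → x ∈ high T xs → ¬ Below T x
  high-not-below T {xs} xs↗ x∈ =
    proj₂ (∈ₚ.∈-filter⁻ (∁? (below? T)) {xs = xs} (subst (_ ∈_) (high-ascending T xs↗) x∈))

  ∈-low : ∀ {T x xs} → Ascending xs → x ∈ xs → Below T x → x ∈ low T xs
  ∈-low {T} {x} xs↗ x∈ x<T = subst (x ∈_) (sym (low-ascending T xs↗)) (∈ₚ.∈-filter⁺ (below? T) x∈ x<T)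

  ∈-low⁻ : ∀ {T x} xs → x ∈ low T xs → x ∈ xs × Below T x
  ∈-low⁻ {T} xs x∈ = subst (_ ∈_) (sym (low++high T xs)) (∈ₚ.∈-++⁺ˡ x∈) , All.lookup (low-below T xs) x∈

  ascending-low-high : ∀ T {xs} → Ascending xs →
    Ascending (low T xs) × Ascending (high T xs) × (∀ {x y} → x ∈ low T xs → y ∈ high T xs → x F.≤ y)
  ascending-low-high T {xs} xs↗ = ascending-++⁻ (low T xs) (subst Ascending (low++high T xs) xs↗)

  -- Dealing a sorted list into blocks of given sizes and thresholds

  Shape : Set
  Shape = List (ℕ × ℕ)

  Nondecreasing : Shape → Set
  Nondecreasing = AllPairs (λ p q → proj₂ p ≤ proj₂ q)

  Fits : List (List (Fin m)) → Shape → Set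
  Fits []       []             = ⊤
  Fits (e ∷ es) ((k , T) ∷ ρ)  = length e ≡ k × All (Below T) e × Fits es ρ
  Fits []       (_ ∷ _)        = ⊥
  Fits (_ ∷ _)  []             = ⊥

  length-Fits : ∀ es ρ → Fits es ρ → length es ≡ length ρ
  length-Fits []       []      _           = refl
  length-Fits (e ∷ es) (_ ∷ ρ) (_ , _ , f) = cong suc (length-Fits es ρ f)

  dealLeast : List (Fin m) → Shape → List (List (Fin m))
  dealLeast xs []             = []
  dealLeast xs ((k , T) ∷ ρ)  = take k xs ∷ dealLeast (drop k xs) ρ

  CanDealLeast : List (Fin m) → Shape → Set
  CanDealLeast xs []            = xs ≡ []
  CanDealLeast xs ((k , T) ∷ ρ) = k ≤ length xs × All (Below T) (take k xs) × CanDealLeast (drop k xs) ρ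

  LeastFirst : List (List (Fin m)) → Set
  LeastFirst []       = ⊤
  LeastFirst (e ∷ es) = (∀ {x y} → y ∈ e → x ∈ concat es → y F.≤ x) × LeastFirst es

  excess : ℕ → ℕ → List (Fin m) → ℕ
  excess k T xs = length (low T xs) ∸ k

  greatestBelow : ℕ → ℕ → List (Fin m) → List (Fin m)
  greatestBelow k T xs = drop (excess k T xs) (low T xs)

  withoutGreatestBelow : ℕ → ℕ → List (Fin m) → List (Fin m)
  withoutGreatestBelow k T xs = take (excess k T xs) (low T xs) ++ high T xs

  dealGreatestBelow : List (Fin m) → Shape → List (List (Fin m))
  dealGreatestBelow xs []            = []
  dealGreatestBelow xs ((k , T) ∷ ρ) = greatestBelow k T xs ∷ dealGreatestBelow (withoutGreatestBelow k T xs) ρ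

  CanDealGreatestBelow : List (Fin m) → Shape → Set
  CanDealGreatestBelow xs []            = xs ≡ []
  CanDealGreatestBelow xs ((k , T) ∷ ρ) = k ≤ length (low T xs) × CanDealGreatestBelow (withoutGreatestBelow k T xs) ρ

  GreatestBelowFirst : List (List (Fin m)) → Shape → Set
  GreatestBelowFirst (e ∷ es) ((k , T) ∷ ρ) =
    (∀ {x y} → y ∈ e → x ∈ concat es → Below T x → x F.≤ y) × GreatestBelowFirst es ρ
  GreatestBelowFirst []       _ = ⊤
  GreatestBelowFirst (_ ∷ _)  [] = ⊤

  length-greatestBelow : ∀ k T xs → k ≤ length (low T xs) →
                         length (take (excess k T xs) (low T xs)) ≡ length (drop k (low T xs))
  length-greatestBelow k T xs p =
    trans (Lₚ.length-take (excess k T xs) (low T xs))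
          (trans (ℕₚ.m≤n⇒m⊓n≡m (ℕₚ.m∸n≤m _ k)) (sym (Lₚ.length-drop k (low T xs))))

  Dominated : ℕ → List (Fin m) → List (Fin m) → Set
  Dominated T₀ = Pointwise (λ x y → x F.≤ y ⊎ Below T₀ x)

  dominated-refl : ∀ {T₀} xs → Dominated T₀ xs xs
  dominated-refl []       = []
  dominated-refl (x ∷ xs) = inj₁ ℕₚ.≤-refl ∷ dominated-refl xs

  dominated-length : ∀ {T₀ xs ys} → Dominated T₀ xs ys → length xs ≡ length ys
  dominated-length []      = refl
  dominated-length (_ ∷ p) = cong suc (dominated-length p)

  dominated-drop : ∀ {T₀ xs ys} k → Dominated T₀ xs ys → Dominated T₀ (drop k xs) (drop k ys)
  dominated-drop zero    p       = p
  dominated-drop (suc k) []      = []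
  dominated-drop (suc k) (_ ∷ p) = dominated-drop k p

  dominated-below : ∀ {T₀ T xs ys} k → T₀ ≤ T → Dominated T₀ xs ys →
                    All (Below T) (take k ys) → All (Below T) (take k xs)
  dominated-below zero    _    _              _            = []
  dominated-below (suc k) _    []             _            = []
  dominated-below (suc k) T₀≤T (inj₁ x≤y ∷ p) (y<T ∷ ys<T) = ℕₚ.≤-<-trans x≤y y<T ∷ dominated-below k T₀≤T p ys<T
  dominated-below (suc k) T₀≤T (inj₂ x<T₀ ∷ p) (_  ∷ ys<T) = ℕₚ.<-≤-trans x<T₀ T₀≤T ∷ dominated-below k T₀≤T p ys<T

  dominated-++ : ∀ {T₀ xs ys} zs → All (Below T₀) xs → length xs ≡ length ys → Dominated T₀ (xs ++ zs) (ys ++ zs)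
  dominated-++ {xs = []}     {[]}     zs _            _ = dominated-refl zs
  dominated-++ {xs = x ∷ xs} {y ∷ ys} zs (x<T₀ ∷ xs<T₀) e = inj₂ x<T₀ ∷ dominated-++ zs xs<T₀ (ℕₚ.suc-injective e)

  canDealLeast-dominated : ∀ {T₀} ρ {xs ys} → All (λ p → T₀ ≤ proj₂ p) ρ → Dominated T₀ xs ys →
                           CanDealLeast ys ρ → CanDealLeast xs ρ
  canDealLeast-dominated []            _              []  refl = refl
  canDealLeast-dominated ((k , T) ∷ ρ) (T₀≤T ∷ T₀≤ρ) xs≼ys (k≤ , ys<T , ok) =
    subst (k ≤_) (sym (dominated-length xs≼ys)) k≤ ,
    dominated-below k T₀≤T xs≼ys ys<T ,
    canDealLeast-dominated ρ T₀≤ρ (dominated-drop k xs≼ys) ok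

  -- Removing the k least or the k greatest entries below T leaves lists that differ only below T.
  canDealLeast⇒canDealGreatestBelow : ∀ ρ xs → Nondecreasing ρ → CanDealLeast xs ρ → CanDealGreatestBelow xs ρ
  canDealLeast⇒canDealGreatestBelow []            xs _            ok = ok
  canDealLeast⇒canDealGreatestBelow ((k , T) ∷ ρ) xs (T≤ρ ∷ ρ↗) (k≤ , xs<T , ok) =
    k≤low , canDealLeast⇒canDealGreatestBelow ρ _ ρ↗ ok′
    where
    k≤low : k ≤ length (low T xs)
    k≤low = ≤length-low k xs k≤ xs<T
    ok′ : CanDealLeast (withoutGreatestBelow k T xs) ρ
    ok′ = canDealLeast-dominated ρ T≤ρ
            (dominated-++ (high T xs) (Allₚ.take⁺ (excess k T xs) (low-below T xs)) (length-greatestBelow k T xs k≤low))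
            (subst (λ ys → CanDealLeast ys ρ) (drop-low k xs k≤low) ok)

  canDealGreatestBelow⇒canDealLeast : ∀ ρ xs → Nondecreasing ρ → CanDealGreatestBelow xs ρ → CanDealLeast xs ρ
  canDealGreatestBelow⇒canDealLeast []            xs _            ok = ok
  canDealGreatestBelow⇒canDealLeast ((k , T) ∷ ρ) xs (T≤ρ ∷ ρ↗) (k≤low , ok) =
    ℕₚ.≤-trans k≤low (length-low≤ T xs) ,
    subst (All (Below T)) (sym (take-low k xs k≤low)) (Allₚ.take⁺ k (low-below T xs)) ,
    subst (λ ys → CanDealLeast ys ρ) (sym (drop-low k xs k≤low))
      (canDealLeast-dominated ρ T≤ρ
        (dominated-++ (high T xs) (Allₚ.drop⁺ k (low-below T xs)) (sym (length-greatestBelow k T xs k≤low)))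
        (canDealGreatestBelow⇒canDealLeast ρ _ ρ↗ ok))

  dealLeast-sound : ∀ ρ xs → Ascending xs → CanDealLeast xs ρ →
    All Ascending (dealLeast xs ρ) × Fits (dealLeast xs ρ) ρ × LeastFirst (dealLeast xs ρ) × concat (dealLeast xs ρ) ≡ xs
  dealLeast-sound []            xs _   ok = [] , tt , tt , sym ok
  dealLeast-sound ((k , T) ∷ ρ) xs xs↗ (k≤ , xs<T , ok)
    with ascending-take-drop k xs↗
  ... | take↗ , drop↗ , take≤drop
    with dealLeast-sound ρ (drop k xs) drop↗ ok
  ... | es↗ , fits , least , concat≡ =
    take↗ ∷ es↗ ,
    (trans (Lₚ.length-take k xs) (ℕₚ.m≤n⇒m⊓n≡m k≤) , xs<T , fits) ,
    ((λ y∈ x∈ → take≤drop y∈ (subst (_ ∈_) concat≡ x∈)) , least) ,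
    trans (cong (take k xs ++_) concat≡) (Lₚ.take++drop≡id k xs)

  ascending-concat : ∀ es → All Ascending es → LeastFirst es → Ascending (concat es)
  ascending-concat []       _          _            = []
  ascending-concat (e ∷ es) (e↗ ∷ es↗) (e≤ , least) = ascending-++⁺ e↗ (ascending-concat es es↗ least) e≤

  dealLeast-concat : ∀ ρ es → Fits es ρ → CanDealLeast (concat es) ρ × dealLeast (concat es) ρ ≡ es
  dealLeast-concat []            []       _                = refl , refl
  dealLeast-concat ((k , T) ∷ ρ) (e ∷ es) (refl , e<T , fits) with dealLeast-concat ρ es fits
  ... | ok , dealt =
    (Lₚ.length-++-≤ˡ e ,
     subst (All (Below T)) (sym (take-length-++ e)) e<T ,
     subst (λ ys → CanDealLeast ys ρ) (sym (drop-length-++ e)) ok) ,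
    cong₂ _∷_ (take-length-++ e) (trans (cong (λ ys → dealLeast ys ρ) (drop-length-++ e)) dealt)

  dealLeast-unique : ∀ ρ es → All Ascending es → LeastFirst es → Fits es ρ →
                     ∀ xs → Ascending xs → xs ↭ concat es → CanDealLeast xs ρ × dealLeast xs ρ ≡ es
  dealLeast-unique ρ es es↗ least fits xs xs↗ xs↭
    with ascending-unique xs↗ (ascending-concat es es↗ least) xs↭
  ... | refl = dealLeast-concat ρ es fits

  ascending-withoutGreatestBelow : ∀ k T {xs} → Ascending xs → Ascending (withoutGreatestBelow k T xs)
  ascending-withoutGreatestBelow k T {xs} xs↗ with ascending-low-high T xs↗
  ... | low↗ , high↗ , low≤high =
    ascending-++⁺ (proj₁ (ascending-take-drop (excess k T xs) low↗)) high↗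
                  (λ x∈ y∈ → low≤high (∈-take⇒∈ (excess k T xs) (low T xs) x∈) y∈)

  greatestBelow-++-without-↭ : ∀ k T xs {ys} → ys ↭ withoutGreatestBelow k T xs → greatestBelow k T xs ++ ys ↭ xs
  greatestBelow-++-without-↭ k T xs {ys} ys↭ =
    ↭-trans (++⁺ˡ (drop d (low T xs)) ys↭)
    (↭-trans (shifts (drop d (low T xs)) (take d (low T xs)))
    (↭-reflexive (trans (sym (Lₚ.++-assoc (take d (low T xs)) (drop d (low T xs)) (high T xs)))
                 (trans (cong (_++ high T xs) (Lₚ.take++drop≡id d (low T xs))) (sym (low++high T xs))))))
    where
    d : ℕ
    d = excess k T xs

  dealGreatestBelow-sound : ∀ ρ xs → Ascending xs → CanDealGreatestBelow xs ρ →
    All Ascending (dealGreatestBelow xs ρ) × Fits (dealGreatestBelow xs ρ) ρ ×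
    GreatestBelowFirst (dealGreatestBelow xs ρ) ρ × concat (dealGreatestBelow xs ρ) ↭ xs
  dealGreatestBelow-sound []            xs _   ok = [] , tt , tt , ↭-reflexive (sym ok)
  dealGreatestBelow-sound ((k , T) ∷ ρ) xs xs↗ (k≤low , ok)
    with ascending-low-high T xs↗
  ... | low↗ , _ , _
    with ascending-take-drop (excess k T xs) low↗
  ... | _ , greatest↗ , rest≤greatest
    with dealGreatestBelow-sound ρ (withoutGreatestBelow k T xs) (ascending-withoutGreatestBelow k T xs↗) ok
  ... | es↗ , fits , greatestFirst , concat↭ =
    greatest↗ ∷ es↗ ,
    (trans (Lₚ.length-drop (excess k T xs) (low T xs)) (ℕₚ.m∸[m∸n]≡n k≤low) ,
     Allₚ.drop⁺ (excess k T xs) (low-below T xs) , fits) ,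
    (greatest≥ , greatestFirst) ,
    greatestBelow-++-without-↭ k T xs concat↭
    where
    greatest≥ : ∀ {x y} → y ∈ greatestBelow k T xs → x ∈ concat (dealGreatestBelow (withoutGreatestBelow k T xs) ρ) →
                Below T x → x F.≤ y
    greatest≥ y∈ x∈ x<T with ∈ₚ.∈-++⁻ (take (excess k T xs) (low T xs)) (∈-resp-↭ concat↭ x∈)
    ... | inj₁ x∈rest = rest≤greatest x∈rest y∈
    ... | inj₂ x∈high = ⊥-elim (high-not-below T xs↗ x∈high x<T)

  greatestBelow-low≡ : ∀ {T xs} ys e → low T xs ≡ ys ++ e →
    greatestBelow (length e) T xs ≡ e × withoutGreatestBelow (length e) T xs ≡ ys ++ high T xs
  greatestBelow-low≡ {T} {xs} ys e low≡ = trans (cong₂ drop excess≡ low≡) (drop-length-++ ys) ,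
                                          cong (_++ high T xs) (trans (cong₂ take excess≡ low≡) (take-length-++ ys))
    where
    excess≡ : excess (length e) T xs ≡ length ys
    excess≡ = trans (cong (λ zs → length zs ∸ length e) low≡)
                    (trans (cong (_∸ length e) (Lₚ.length-++ ys)) (ℕₚ.m+n∸n≡m (length ys) (length e)))

  module _ {T : ℕ} {e R xs : List (Fin m)} (xs↗ : Ascending xs) (xs↭ : xs ↭ e ++ R) (e<T : All (Below T) e) where

    low-↭ : low T xs ↭ e ++ filter (below? T) R
    low-↭ = ↭-trans (↭-reflexive (low-ascending T xs↗))
            (↭-trans (filter-↭ (below? T) xs↭)
            (↭-reflexive (trans (Lₚ.filter-++ (below? T) e R) (cong (_++ _) (Lₚ.filter-all (below? T) e<T)))))

    high-↭ : high T xs ↭ filter (∁? (below? T)) R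
    high-↭ = ↭-trans (↭-reflexive (high-ascending T xs↗))
             (↭-trans (filter-↭ (∁? (below? T)) xs↭)
             (↭-reflexive (trans (Lₚ.filter-++ (∁? (below? T)) e R)
                                 (cong (_++ _) (Lₚ.filter-none (∁? (below? T)) (All.map (λ x<T x≮T → x≮T x<T) e<T))))))

    low≡sort-++ : Ascending e → (∀ {x y} → y ∈ e → x ∈ R → Below T x → x F.≤ y) →
                  low T xs ≡ sort (filter (below? T) R) ++ e
    low≡sort-++ e↗ e≥ = sym (ascending-unique sorted++e (proj₁ (ascending-low-high T xs↗))
        (↭-trans (++⁺ʳ e (sort-↭ _)) (↭-trans (++-comm _ e) (↭-sym low-↭))))
      where
      sorted++e : Ascending (sort (filter (below? T) R) ++ e)
      sorted++e = ascending-++⁺ (ascending-sort _) e↗ λ x∈ y∈ →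
        let x∈R , x<T = ∈ₚ.∈-filter⁻ (below? T) {xs = R} (∈-resp-↭ (sort-↭ _) x∈) in e≥ y∈ x∈R x<T

  dealGreatestBelow-unique : ∀ ρ es → All Ascending es → GreatestBelowFirst es ρ → Fits es ρ →
    ∀ xs → Ascending xs → xs ↭ concat es → CanDealGreatestBelow xs ρ × dealGreatestBelow xs ρ ≡ es
  dealGreatestBelow-unique []            []       _          _                   _                  xs _   xs↭ =
    ↭-empty-inv xs↭ , refl
  dealGreatestBelow-unique ((k , T) ∷ ρ) (e ∷ es) (e↗ ∷ es↗) (e≥ , greatestFirst) (refl , e<T , fits) xs xs↗ xs↭
    with greatestBelow-low≡ {T} {xs} _ e (low≡sort-++ xs↗ xs↭ e<T e↗ e≥)
  ... | greatest≡ , without≡ =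
    (k≤low , subst (λ ys → CanDealGreatestBelow ys ρ) (sym without≡) (proj₁ ih)) ,
    cong₂ _∷_ greatest≡ (trans (cong (λ ys → dealGreatestBelow ys ρ) without≡) (proj₂ ih))
    where
    R : List (Fin m)
    R = concat es
    rest : List (Fin m)
    rest = sort (filter (below? T) R) ++ high T xs
    rest↗ : Ascending rest
    rest↗ = ascending-++⁺ (ascending-sort _) (proj₁ (proj₂ (ascending-low-high T xs↗))) λ x∈ y∈ →
      ℕₚ.<⇒≤ (ℕₚ.<-≤-trans (proj₂ (∈ₚ.∈-filter⁻ (below? T) {xs = R} (∈-resp-↭ (sort-↭ _) x∈)))
                            (ℕₚ.≮⇒≥ (high-not-below T xs↗ y∈)))
    ih : CanDealGreatestBelow rest ρ × dealGreatestBelow rest ρ ≡ es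
    ih = dealGreatestBelow-unique ρ es es↗ greatestFirst fits rest rest↗
           (↭-trans (++⁺ (sort-↭ _) (high-↭ xs↗ xs↭ e<T)) (filter-++-filter-∁-↭ (below? T) R))
    k≤low : length e ≤ length (low T xs)
    k≤low = subst (λ zs → length e ≤ length zs) (sym (low≡sort-++ xs↗ xs↭ e<T e↗ e≥))
                  (subst (length e ≤_) (sym (Lₚ.length-++ (sort (filter (below? T) R)))) (ℕₚ.m≤n+m _ _))

  -- Low and high parts of an array

  sup : List (Fin m) → ℕ
  sup []       = 0
  sup (x ∷ xs) = toℕ x ⊔ sup xs

  sup-++ : ∀ xs ys → sup (xs ++ ys) ≡ sup xs ⊔ sup ys
  sup-++ []       ys = refl
  sup-++ (x ∷ xs) ys = trans (cong (toℕ x ⊔_) (sup-++ xs ys)) (sym (ℕₚ.⊔-assoc (toℕ x) (sup xs) (sup ys)))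

  sup≤ : ∀ {T} xs → All (Below T) xs → sup xs ≤ T
  sup≤ []       _            = z≤n
  sup≤ (x ∷ xs) (x<T ∷ xs<T) = ℕₚ.⊔-lub (ℕₚ.<⇒≤ x<T) (sup≤ xs xs<T)

  ≤sup : ∀ {x xs} → x ∈ xs → toℕ x ≤ sup xs
  ≤sup {x} {_ ∷ xs} (here refl) = ℕₚ.m≤m⊔n (toℕ x) (sup xs)
  ≤sup {x} {y ∷ xs} (there x∈)  = ℕₚ.≤-trans (≤sup x∈) (ℕₚ.m≤n⊔m (toℕ y) (sup xs))

  <sup⇒∃ : ∀ {y : Fin m} xs → toℕ y < sup xs → Σ (Fin m) λ z → z ∈ xs × toℕ y < toℕ z
  <sup⇒∃ {y} (x ∷ xs) y<sup with toℕ y ℕ.<? toℕ x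
  ... | yes y<x = x , here refl , y<x
  ... | no  y≮x with ℕₚ.≤-total (toℕ x) (sup xs)
  ...   | inj₂ x≥sup = ⊥-elim (y≮x (subst (toℕ y <_) (ℕₚ.m≥n⇒m⊔n≡m x≥sup) y<sup))
  ...   | inj₁ x≤sup with <sup⇒∃ xs (subst (toℕ y <_) (ℕₚ.m≤n⇒m⊔n≡n x≤sup) y<sup)
  ...     | z , z∈ , y<z = z , there z∈ , y<z

  ⊔-absorb : ∀ {a t} c → a ≤ t → t ⊔ (a ⊔ c) ≡ t ⊔ c
  ⊔-absorb {a} {t} c a≤t = trans (sym (ℕₚ.⊔-assoc t a c)) (cong (_⊔ c) (ℕₚ.m≥n⇒m⊔n≡m a≤t))

  ⊔-sup-high : ∀ t xs → t ⊔ sup xs ≡ t ⊔ sup (high t xs)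
  ⊔-sup-high t xs = trans (cong (λ ys → t ⊔ sup ys) (low++high t xs))
                    (trans (cong (t ⊔_) (sup-++ (low t xs) (high t xs)))
                           (⊔-absorb (sup (high t xs)) (sup≤ (low t xs) (low-below t xs))))

  -- The blocks are listed from right to left and t is the largest entry to the right of the
  -- current block, so low t b holds the entries of b smaller than some entry to its right.
  lows : ℕ → List (List (Fin m)) → List (List (Fin m))
  lows t []       = []
  lows t (b ∷ bs) = low t b ∷ lows (t ⊔ sup b) bs

  highs : ℕ → List (List (Fin m)) → List (List (Fin m))
  highs t []       = []
  highs t (b ∷ bs) = high t b ∷ highs (t ⊔ sup b) bs

  shape : ℕ → List (List (Fin m)) → Shape
  shape t []       = []
  shape t (b ∷ bs) = (length (low t b) , t) ∷ shape (t ⊔ sup b) bs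

  glue : List (List (Fin m)) → List (List (Fin m)) → List (List (Fin m))
  glue = zipWith _++_

  glue-lows-highs : ∀ t bs → glue (lows t bs) (highs t bs) ≡ bs
  glue-lows-highs t []       = refl
  glue-lows-highs t (b ∷ bs) = cong₂ _∷_ (sym (low++high t b)) (glue-lows-highs (t ⊔ sup b) bs)

  length-shape : ∀ t bs → length (shape t bs) ≡ length bs
  length-shape t []       = refl
  length-shape t (b ∷ bs) = cong suc (length-shape (t ⊔ sup b) bs)

  length-lows : ∀ t bs → length (lows t bs) ≡ length bs
  length-lows t []       = refl
  length-lows t (b ∷ bs) = cong suc (length-lows (t ⊔ sup b) bs)

  length-highs : ∀ t bs → length (highs t bs) ≡ length bs
  length-highs t []       = refl
  length-highs t (b ∷ bs) = cong suc (length-highs (t ⊔ sup b) bs)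

  fits-lows : ∀ t bs → Fits (lows t bs) (shape t bs)
  fits-lows t []       = tt
  fits-lows t (b ∷ bs) = refl , low-below t b , fits-lows (t ⊔ sup b) bs

  ascending-lows : ∀ t bs → All Ascending bs → All Ascending (lows t bs)
  ascending-lows t []       _          = []
  ascending-lows t (b ∷ bs) (b↗ ∷ bs↗) = proj₁ (ascending-low-high t b↗) ∷ ascending-lows (t ⊔ sup b) bs bs↗

  shape-≥ : ∀ {t t′} bs → t ≤ t′ → All (λ p → t ≤ proj₂ p) (shape t′ bs)
  shape-≥ []       _    = []
  shape-≥ {t} {t′} (b ∷ bs) t≤t′ = t≤t′ ∷ shape-≥ bs (ℕₚ.≤-trans t≤t′ (ℕₚ.m≤m⊔n t′ (sup b)))

  shape-nondecreasing : ∀ t bs → Nondecreasing (shape t bs)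
  shape-nondecreasing t []       = []
  shape-nondecreasing t (b ∷ bs) = shape-≥ bs (ℕₚ.m≤m⊔n t (sup b)) ∷ shape-nondecreasing (t ⊔ sup b) bs

  ascending-glue : ∀ t bs es → All Ascending bs → All Ascending es → Fits es (shape t bs) →
                   All Ascending (glue es (highs t bs))
  ascending-glue t []       []       _          _          _               = []
  ascending-glue t (b ∷ bs) (e ∷ es) (b↗ ∷ bs↗) (e↗ ∷ es↗) (_ , e<t , fits) =
    ascending-++⁺ e↗ (proj₁ (proj₂ (ascending-low-high t b↗)))
      (λ x∈ y∈ → ℕₚ.<⇒≤ (ℕₚ.<-≤-trans (All.lookup e<t x∈) (ℕₚ.≮⇒≥ (high-not-below t b↗ y∈))))
    ∷ ascending-glue (t ⊔ sup b) bs es bs↗ es↗ fits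

  map-length-glue : ∀ t bs es → Fits es (shape t bs) → map length (glue es (highs t bs)) ≡ map length bs
  map-length-glue t []       []       _                 = refl
  map-length-glue t (b ∷ bs) (e ∷ es) (|e|≡ , _ , fits) =
    cong₂ _∷_ (begin
                 length (e ++ high t b)              ≡⟨ Lₚ.length-++ e ⟩
                 length e + length (high t b)        ≡⟨ cong (_+ length (high t b)) |e|≡ ⟩
                 length (low t b) + length (high t b) ≡⟨ Lₚ.length-++ (low t b) ⟨
                 length (low t b ++ high t b)        ≡⟨ cong length (low++high t b) ⟨
                 length b                            ∎)
              (map-length-glue (t ⊔ sup b) bs es fits)
    where open ≡-Reasoning

  decompose-glue : ∀ t bs es → Fits es (shape t bs) →
    lows t (glue es (highs t bs)) ≡ es × highs t (glue es (highs t bs)) ≡ highs t bs ×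
    shape t (glue es (highs t bs)) ≡ shape t bs
  decompose-glue t []       []       _                 = refl , refl , refl
  decompose-glue t (b ∷ bs) (e ∷ es) (|e|≡ , e<t , fits) with decompose-glue (t ⊔ sup b) bs es fits
  ... | lows≡ , highs≡ , shape≡ =
    cong₂ _∷_ low≡ (trans (cong (λ s → lows s rest) t′≡) lows≡) ,
    cong₂ _∷_ high≡ (trans (cong (λ s → highs s rest) t′≡) highs≡) ,
    cong₂ _∷_ (cong (_, t) (trans (cong length low≡) |e|≡)) (trans (cong (λ s → shape s rest) t′≡) shape≡)
    where
    rest : List (List (Fin m))
    rest = glue es (highs (t ⊔ sup b) bs)
    low≡ : low t (e ++ high t b) ≡ e
    low≡ = trans (low-++ e (high t b) e<t) (trans (cong (e ++_) (low-high t b)) (Lₚ.++-identityʳ e))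
    high≡ : high t (e ++ high t b) ≡ high t b
    high≡ = trans (high-++ e (high t b) e<t) (high-high t b)
    t′≡ : t ⊔ sup (e ++ high t b) ≡ t ⊔ sup b
    t′≡ = trans (cong (t ⊔_) (sup-++ e (high t b)))
                (trans (⊔-absorb (sup (high t b)) (sup≤ e e<t)) (sym (⊔-sup-high t b)))

  ∈-lows⁻ : ∀ {x} t bs → x ∈ concat (lows t bs) → x ∈ concat bs
  ∈-lows⁻ t (b ∷ bs) x∈ with ∈ₚ.∈-++⁻ (low t b) x∈
  ... | inj₁ x∈low  = ∈ₚ.∈-++⁺ˡ (proj₁ (∈-low⁻ b x∈low))
  ... | inj₂ x∈lows = ∈ₚ.∈-++⁺ʳ b (∈-lows⁻ (t ⊔ sup b) bs x∈lows)

  ∈-lows : ∀ {x} t bs → All Ascending bs → x ∈ concat bs → Below t x → x ∈ concat (lows t bs)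
  ∈-lows t (b ∷ bs) (b↗ ∷ bs↗) x∈ x<t with ∈ₚ.∈-++⁻ b x∈
  ... | inj₁ x∈b  = ∈ₚ.∈-++⁺ˡ (∈-low b↗ x∈b x<t)
  ... | inj₂ x∈bs = ∈ₚ.∈-++⁺ʳ (low t b) (∈-lows (t ⊔ sup b) bs bs↗ x∈bs (ℕₚ.<-≤-trans x<t (ℕₚ.m≤m⊔n t (sup b))))

  EveryPair : (ℕ → Fin m → Fin m → Set) → ℕ → List (List (Fin m)) → Set
  EveryPair Q t []       = ⊤
  EveryPair Q t (b ∷ bs) = (∀ {x y} → y ∈ b → x ∈ concat bs → Q t x y) × EveryPair Q (t ⊔ sup b) bs

  Guard123 : ℕ → Fin m → Fin m → Set
  Guard123 t x y = Below t y → y F.≤ x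

  Guard213 : ℕ → Fin m → Fin m → Set
  Guard213 t x y = Below t x → x F.≤ y

  guard123⇒leastFirst : ∀ t bs → EveryPair Guard123 t bs → LeastFirst (lows t bs)
  guard123⇒leastFirst t []       _          = tt
  guard123⇒leastFirst t (b ∷ bs) (g , every) =
    (λ y∈ x∈ → let y∈b , y<t = ∈-low⁻ b y∈ in g y∈b (∈-lows⁻ (t ⊔ sup b) bs x∈) y<t) ,
    guard123⇒leastFirst (t ⊔ sup b) bs every

  leastFirst⇒guard123 : ∀ t bs → All Ascending bs → LeastFirst (lows t bs) → EveryPair Guard123 t bs
  leastFirst⇒guard123 t []       _          _              = tt
  leastFirst⇒guard123 t (b ∷ bs) (b↗ ∷ bs↗) (least , rest) = guard , leastFirst⇒guard123 (t ⊔ sup b) bs bs↗ rest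
    where
    guard : ∀ {x y} → y ∈ b → x ∈ concat bs → Guard123 t x y
    guard {x} y∈ x∈ y<t with toℕ x ℕ.<? (t ⊔ sup b)
    ... | yes x<t′ = least (∈-low b↗ y∈ y<t) (∈-lows (t ⊔ sup b) bs bs↗ x∈ x<t′)
    ... | no  x≮t′ = ℕₚ.<⇒≤ (ℕₚ.<-≤-trans y<t (ℕₚ.≤-trans (ℕₚ.m≤m⊔n t (sup b)) (ℕₚ.≮⇒≥ x≮t′)))

  guard213⇒greatestBelowFirst : ∀ t bs → EveryPair Guard213 t bs → GreatestBelowFirst (lows t bs) (shape t bs)
  guard213⇒greatestBelowFirst t []       _          = tt
  guard213⇒greatestBelowFirst t (b ∷ bs) (g , every) =
    (λ y∈ x∈ x<t → g (proj₁ (∈-low⁻ b y∈)) (∈-lows⁻ (t ⊔ sup b) bs x∈) x<t) ,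
    guard213⇒greatestBelowFirst (t ⊔ sup b) bs every

  greatestBelowFirst⇒guard213 : ∀ t bs → All Ascending bs → GreatestBelowFirst (lows t bs) (shape t bs) →
                                EveryPair Guard213 t bs
  greatestBelowFirst⇒guard213 t []       _          _                 = tt
  greatestBelowFirst⇒guard213 t (b ∷ bs) (b↗ ∷ bs↗) (greatest , rest) =
    guard , greatestBelowFirst⇒guard213 (t ⊔ sup b) bs bs↗ rest
    where
    guard : ∀ {x y} → y ∈ b → x ∈ concat bs → Guard213 t x y
    guard {y = y} y∈ x∈ x<t with toℕ y ℕ.<? t
    ... | yes y<t = greatest (∈-low b↗ y∈ y<t) (∈-lows (t ⊔ sup b) bs bs↗ x∈ (ℕₚ.<-≤-trans x<t (ℕₚ.m≤m⊔n t (sup b)))) x<t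
    ... | no  y≮t = ℕₚ.<⇒≤ (ℕₚ.<-≤-trans x<t (ℕₚ.≮⇒≥ y≮t))

  -- Pattern occurrences

  Triple : Set₁
  Triple = Fin m → Fin m → Fin m → Set

  Is123 : Triple
  Is123 x y z = x F.< y × y F.< z

  Is213 : Triple
  Is213 x y z = y F.< x × x F.< z

  Reversed : Triple → Triple
  Reversed P x y z = P z y x

  record Occurs (P : Triple) (τ : List (List (Fin m))) : Set where
    constructor occurs
    field
      before : List (List (Fin m))
      block  : List (Fin m)
      after  : List (List (Fin m))
      split  : τ ≡ before ++ block ∷ after
      {x y z} : Fin m
      x∈ : x ∈ concat before
      y∈ : y ∈ block
      z∈ : z ∈ concat after
      ordered : P x y z

  occurs-reverse : ∀ {P} τ → Occurs P τ → Occurs (Reversed P) (reverse τ)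
  occurs-reverse τ (occurs U b V refl x∈ y∈ z∈ pat) =
    occurs (reverse V) b (reverse U) (reverse-++-∷ U b V) (∈-concat-reverse V z∈) y∈ (∈-concat-reverse U x∈) pat

  occurs-reverse⁻ : ∀ {P} υ → Occurs (Reversed P) (reverse υ) → Occurs P υ
  occurs-reverse⁻ {P} υ occ = subst (Occurs P) (Lₚ.reverse-involutive υ) (occurs-reverse (reverse υ) occ)

  everyPair-++ : ∀ Q t (U W : List (List (Fin m))) → EveryPair Q t (U ++ W) → EveryPair Q (t ⊔ sup (concat U)) W
  everyPair-++ Q t []      W every = subst (λ s → EveryPair Q s W) (sym (ℕₚ.⊔-identityʳ t)) every
  everyPair-++ Q t (b ∷ U) W (_ , every) =
    subst (λ s → EveryPair Q s W)
          (trans (ℕₚ.⊔-assoc t (sup b) (sup (concat U))) (cong (t ⊔_) (sym (sup-++ b (concat U)))))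
          (everyPair-++ Q (t ⊔ sup b) U W every)

  module Guarding (Q : ℕ → Fin m → Fin m → Set) (P : Triple)
    (excludes : ∀ {t x y z} → Q t x y → toℕ z ≤ t → ¬ P x y z)
    (introduces : ∀ {x y} zs → (∀ {z} → z ∈ zs → ¬ P x y z) → Q (sup zs) x y) where

    everyPair⇒¬occurs : ∀ υ → EveryPair Q 0 υ → ¬ Occurs (Reversed P) υ
    everyPair⇒¬occurs υ every (occurs U b V refl z∈ y∈ x∈ pat) =
      excludes (proj₁ (everyPair-++ Q 0 U (b ∷ V) every) y∈ x∈) (≤sup z∈) pat

    ¬occurs-++⇒everyPair : ∀ U W → ¬ Occurs (Reversed P) (U ++ W) → EveryPair Q (sup (concat U)) W
    ¬occurs-++⇒everyPair U []      _    = tt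
    ¬occurs-++⇒everyPair U (b ∷ V) ¬occ =
      (λ y∈ x∈ → introduces (concat U) λ z∈ pat → ¬occ (occurs U b V refl z∈ y∈ x∈ pat)) ,
      subst (λ t → EveryPair Q t V) sup≡
            (¬occurs-++⇒everyPair (U ∷ʳ b) V (subst (λ τ → ¬ Occurs (Reversed P) τ) (sym (Lₚ.∷ʳ-++ U b V)) ¬occ))
      where
      sup≡ : sup (concat (U ∷ʳ b)) ≡ sup (concat U) ⊔ sup b
      sup≡ = trans (cong sup (concat-∷ʳ U b)) (sup-++ (concat U) b)

    ¬occurs⇒everyPair : ∀ υ → ¬ Occurs (Reversed P) υ → EveryPair Q 0 υ
    ¬occurs⇒everyPair = ¬occurs-++⇒everyPair []

  guard123-excludes : ∀ {t x y z} → Guard123 t x y → toℕ z ≤ t → ¬ Is123 x y z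
  guard123-excludes guard z≤t (x<y , y<z) = ℕₚ.<-irrefl refl (ℕₚ.<-≤-trans x<y (guard (ℕₚ.<-≤-trans y<z z≤t)))

  guard213-excludes : ∀ {t x y z} → Guard213 t x y → toℕ z ≤ t → ¬ Is213 x y z
  guard213-excludes guard z≤t (y<x , x<z) = ℕₚ.<-irrefl refl (ℕₚ.<-≤-trans y<x (guard (ℕₚ.<-≤-trans x<z z≤t)))

  guard123-introduces : ∀ {x y} zs → (∀ {z} → z ∈ zs → ¬ Is123 x y z) → Guard123 (sup zs) x y
  guard123-introduces {x} {y} zs ¬pat y<sup with <sup⇒∃ zs y<sup
  ... | z , z∈ , y<z with toℕ y ℕ.≤? toℕ x
  ...   | yes y≤x = y≤x
  ...   | no  y≰x = ⊥-elim (¬pat z∈ (ℕₚ.≰⇒> y≰x , y<z))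

  guard213-introduces : ∀ {x y} zs → (∀ {z} → z ∈ zs → ¬ Is213 x y z) → Guard213 (sup zs) x y
  guard213-introduces {x} {y} zs ¬pat x<sup with <sup⇒∃ zs x<sup
  ... | z , z∈ , x<z with toℕ x ℕ.≤? toℕ y
  ...   | yes x≤y = x≤y
  ...   | no  x≰y = ⊥-elim (¬pat z∈ (ℕₚ.≰⇒> x≰y , x<z))

  module Guarding123 = Guarding Guard123 Is123 guard123-excludes guard123-introduces
  module Guarding213 = Guarding Guard213 Is213 guard213-excludes guard213-introduces

  ∈-lookup⇒∈-concat : ∀ {x} (τ : List (List (Fin m))) i → x ∈ L.lookup τ i → x ∈ concat τ
  ∈-lookup⇒∈-concat (b ∷ τ) F.zero    x∈ = ∈ₚ.∈-++⁺ˡ x∈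
  ∈-lookup⇒∈-concat (b ∷ τ) (F.suc i) x∈ = ∈ₚ.∈-++⁺ʳ b (∈-lookup⇒∈-concat τ i x∈)

  ∈-lookup⇒∈-concat-take : ∀ {x} (τ : List (List (Fin m))) (i j : Fin (length τ)) → i F.< j → x ∈ L.lookup τ i →
                           x ∈ concat (take (toℕ j) τ)
  ∈-lookup⇒∈-concat-take (b ∷ τ) F.zero    (F.suc j) _       x∈ = ∈ₚ.∈-++⁺ˡ x∈
  ∈-lookup⇒∈-concat-take (b ∷ τ) (F.suc i) (F.suc j) (s≤s i<j) x∈ = ∈ₚ.∈-++⁺ʳ b (∈-lookup⇒∈-concat-take τ i j i<j x∈)

  ∈-lookup⇒∈-concat-drop : ∀ {x} (τ : List (List (Fin m))) (i j : Fin (length τ)) → j F.< i → x ∈ L.lookup τ i →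
                           x ∈ concat (drop (suc (toℕ j)) τ)
  ∈-lookup⇒∈-concat-drop (b ∷ τ) (F.suc i) F.zero    _         x∈ = ∈-lookup⇒∈-concat τ i x∈
  ∈-lookup⇒∈-concat-drop (b ∷ τ) (F.suc i) (F.suc j) (s≤s j<i) x∈ = ∈-lookup⇒∈-concat-drop τ i j j<i x∈

  take-lookup-drop : ∀ (τ : List (List (Fin m))) j → τ ≡ take (toℕ j) τ ++ L.lookup τ j ∷ drop (suc (toℕ j)) τ
  take-lookup-drop (b ∷ τ) F.zero    = refl
  take-lookup-drop (b ∷ τ) (F.suc j) = cong (b ∷_) (take-lookup-drop τ j)

  ∈-concat⇒lookup : ∀ {x} (τ : List (List (Fin m))) → x ∈ concat τ → Σ (Fin (length τ)) λ j → x ∈ L.lookup τ j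
  ∈-concat⇒lookup (b ∷ τ) x∈ with ∈ₚ.∈-++⁻ b x∈
  ... | inj₁ x∈b = F.zero , x∈b
  ... | inj₂ x∈τ with ∈-concat⇒lookup τ x∈τ
  ...   | j , x∈j = F.suc j , x∈j

  ∈-concat-before : ∀ {x} (U : List (List (Fin m))) W → x ∈ concat U →
                    Σ (Fin (length (U ++ W))) λ j → toℕ j < length U × x ∈ L.lookup (U ++ W) j
  ∈-concat-before (u ∷ U) W x∈ with ∈ₚ.∈-++⁻ u x∈
  ... | inj₁ x∈u = F.zero , s≤s z≤n , x∈u
  ... | inj₂ x∈U with ∈-concat-before U W x∈U
  ...   | j , j< , x∈j = F.suc j , s≤s j< , x∈j

  lookup-middle : ∀ (U : List (List (Fin m))) b V →
                  Σ (Fin (length (U ++ b ∷ V))) λ j → toℕ j ≡ length U × L.lookup (U ++ b ∷ V) j ≡ b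
  lookup-middle []      b V = F.zero , refl , refl
  lookup-middle (u ∷ U) b V with lookup-middle U b V
  ... | j , j≡ , lookup≡ = F.suc j , cong suc j≡ , lookup≡

  ∈-concat-after : ∀ {x} (U : List (List (Fin m))) b V → x ∈ concat V →
                   Σ (Fin (length (U ++ b ∷ V))) λ j → length U < toℕ j × x ∈ L.lookup (U ++ b ∷ V) j
  ∈-concat-after []      b V x∈ with ∈-concat⇒lookup V x∈
  ... | j , x∈j = F.suc j , s≤s z≤n , x∈j
  ∈-concat-after (u ∷ U) b V x∈ with ∈-concat-after U b V x∈
  ... | j , <j , x∈j = F.suc j , s≤s <j , x∈j

  triple : ∀ {X : Set} → X → X → X → Fin 3 → X
  triple a b c 0F = a
  triple a b c 1F = b
  triple a b c 2F = c

  ⇔-order : ∀ (π : Pattern) (x : Fin 3 → Fin m) → (∀ s t → π s < π t → x s F.< x t) →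
            (∀ s t → π s ≡ π t → s ≡ t) → ∀ s t → (x s F.< x t) ⇔ (π s < π t)
  ⇔-order π x mono inj s t = mk⇔ reflect (mono s t)
    where
    reflect : x s F.< x t → π s < π t
    reflect xs<xt with ℕₚ.<-cmp (π s) (π t)
    ... | tri< πs<πt _ _ = πs<πt
    ... | tri≈ _ πs≡πt _ = ⊥-elim (ℕₚ.<-irrefl (cong (λ r → toℕ (x r)) (inj s t πs≡πt)) xs<xt)
    ... | tri> _ _ πs>πt = ⊥-elim (ℕₚ.<-asym xs<xt (mono t s πs>πt))

  contains⇒occurs : ∀ (π : Pattern) (P : Triple) →
    (∀ (x : Fin 3 → Fin m) → (∀ s t → (x s F.< x t) ⇔ (π s < π t)) → P (x 0F) (x 1F) (x 2F)) →
    ∀ τ → Contains π τ → Occurs P τ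
  contains⇒occurs π P ordered τ (i , i₀<i₁ , i₁<i₂ , x , x∈ , iso) =
    occurs (take (toℕ j) τ) (L.lookup τ j) (drop (suc (toℕ j)) τ) (take-lookup-drop τ j)
      (∈-lookup⇒∈-concat-take τ (i 0F) j i₀<i₁ (x∈ 0F)) (x∈ 1F)
      (∈-lookup⇒∈-concat-drop τ (i 2F) j i₁<i₂ (x∈ 2F)) (ordered x iso)
    where
    j = i 1F

  occurs⇒contains : ∀ (π : Pattern) (P : Triple) →
    (∀ {a b c} → P a b c → ∀ s t → π s < π t → triple a b c s F.< triple a b c t) →
    (∀ s t → π s ≡ π t → s ≡ t) →
    ∀ τ → Occurs P τ → Contains π τ
  occurs⇒contains π P mono inj τ (occurs U b V refl {x} {y} {z} x∈ y∈ z∈ pat)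
    with ∈-concat-before U (b ∷ V) x∈ | lookup-middle U b V | ∈-concat-after U b V z∈
  ... | i₀ , i₀< , x∈i₀ | i₁ , i₁≡ , lookup≡ | i₂ , <i₂ , z∈i₂ =
    triple i₀ i₁ i₂ , subst (toℕ i₀ <_) (sym i₁≡) i₀< , subst (_< toℕ i₂) (sym i₁≡) <i₂ ,
    triple x y z , member , ⇔-order π (triple x y z) (mono pat) inj
    where
    member : ∀ s → triple x y z s ∈ L.lookup (U ++ b ∷ V) (triple i₀ i₁ i₂ s)
    member 0F = x∈i₀
    member 1F = subst (y ∈_) (sym lookup≡) y∈
    member 2F = z∈i₂

  is123-ordered : ∀ (x : Fin 3 → Fin m) → (∀ s t → (x s F.< x t) ⇔ (p123 s < p123 t)) → Is123 (x 0F) (x 1F) (x 2F)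
  is123-ordered x iso = Equivalence.from (iso 0F 1F) ℕₚ.≤-refl , Equivalence.from (iso 1F 2F) ℕₚ.≤-refl

  is213-ordered : ∀ (x : Fin 3 → Fin m) → (∀ s t → (x s F.< x t) ⇔ (p213 s < p213 t)) → Is213 (x 0F) (x 1F) (x 2F)
  is213-ordered x iso = Equivalence.from (iso 1F 0F) ℕₚ.≤-refl , Equivalence.from (iso 0F 2F) ℕₚ.≤-refl

  is123-monotone : ∀ {a b c} → Is123 a b c → ∀ s t → p123 s < p123 t → triple a b c s F.< triple a b c t
  is123-monotone (a<b , b<c) 0F 1F _ = a<b
  is123-monotone (a<b , b<c) 0F 2F _ = ℕₚ.<-trans a<b b<c
  is123-monotone (a<b , b<c) 1F 2F _ = b<c
  is123-monotone _ 0F 0F (s≤s ())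
  is123-monotone _ 1F 0F (s≤s ())
  is123-monotone _ 1F 1F (s≤s (s≤s ()))
  is123-monotone _ 2F 0F (s≤s ())
  is123-monotone _ 2F 1F (s≤s (s≤s ()))
  is123-monotone _ 2F 2F (s≤s (s≤s (s≤s ())))

  is213-monotone : ∀ {a b c} → Is213 a b c → ∀ s t → p213 s < p213 t → triple a b c s F.< triple a b c t
  is213-monotone (b<a , a<c) 1F 0F _ = b<a
  is213-monotone (b<a , a<c) 0F 2F _ = a<c
  is213-monotone (b<a , a<c) 1F 2F _ = ℕₚ.<-trans b<a a<c
  is213-monotone _ 0F 0F (s≤s (s≤s ()))
  is213-monotone _ 0F 1F (s≤s ())
  is213-monotone _ 1F 1F (s≤s ())
  is213-monotone _ 2F 0F (s≤s (s≤s ()))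
  is213-monotone _ 2F 1F (s≤s ())
  is213-monotone _ 2F 2F (s≤s (s≤s (s≤s ())))

  p123-injective : ∀ s t → p123 s ≡ p123 t → s ≡ t
  p123-injective 0F 0F _ = refl
  p123-injective 1F 1F _ = refl
  p123-injective 2F 2F _ = refl
  p123-injective 0F 1F ()
  p123-injective 0F 2F ()
  p123-injective 1F 0F ()
  p123-injective 1F 2F ()
  p123-injective 2F 0F ()
  p123-injective 2F 1F ()

  p213-injective : ∀ s t → p213 s ≡ p213 t → s ≡ t
  p213-injective 0F 0F _ = refl
  p213-injective 1F 1F _ = refl
  p213-injective 2F 2F _ = refl
  p213-injective 0F 1F ()
  p213-injective 0F 2F ()
  p213-injective 1F 0F ()
  p213-injective 1F 2F ()
  p213-injective 2F 0F ()
  p213-injective 2F 1F ()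

  avoids123⇔everyPair : ∀ τ → Avoids p123 τ ⇔ EveryPair Guard123 0 (reverse τ)
  avoids123⇔everyPair τ = mk⇔
    (λ avoid → Guarding123.¬occurs⇒everyPair (reverse τ) λ occ →
      avoid (occurs⇒contains p123 Is123 is123-monotone p123-injective τ (occurs-reverse⁻ τ occ)))
    (λ every c → Guarding123.everyPair⇒¬occurs (reverse τ) every
      (occurs-reverse τ (contains⇒occurs p123 Is123 is123-ordered τ c)))

  avoids213⇔everyPair : ∀ τ → Avoids p213 τ ⇔ EveryPair Guard213 0 (reverse τ)
  avoids213⇔everyPair τ = mk⇔
    (λ avoid → Guarding213.¬occurs⇒everyPair (reverse τ) λ occ →
      avoid (occurs⇒contains p213 Is213 is213-monotone p213-injective τ (occurs-reverse⁻ τ occ)))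
    (λ every c → Guarding213.everyPair⇒¬occurs (reverse τ) every
      (occurs-reverse τ (contains⇒occurs p213 Is213 is213-ordered τ c)))

  -- Redealing the low entries

  record Dealing : Set₁ where
    field
      avoided  : Pattern
      deal     : List (Fin m) → Shape → List (List (Fin m))
      CanDeal  : List (Fin m) → Shape → Set
      Arranged : List (List (Fin m)) → Shape → Set
      sound    : ∀ ρ xs → Ascending xs → CanDeal xs ρ →
                 All Ascending (deal xs ρ) × Fits (deal xs ρ) ρ × Arranged (deal xs ρ) ρ × concat (deal xs ρ) ↭ xs
      unique   : ∀ ρ es → All Ascending es → Arranged es ρ → Fits es ρ →
                 ∀ xs → Ascending xs → xs ↭ concat es → CanDeal xs ρ × deal xs ρ ≡ es
      avoids⇒arranged : ∀ τ → Avoids avoided τ → Arranged (lows 0 (reverse τ)) (shape 0 (reverse τ))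
      arranged⇒avoids : ∀ τ → All Ascending (reverse τ) → Arranged (lows 0 (reverse τ)) (shape 0 (reverse τ)) →
                        Avoids avoided τ

  leastDealing : Dealing
  leastDealing = record
    { avoided  = p123
    ; deal     = dealLeast
    ; CanDeal  = CanDealLeast
    ; Arranged = λ es _ → LeastFirst es
    ; sound    = λ ρ xs xs↗ ok → let es↗ , fits , leastFirst , concat≡ = dealLeast-sound ρ xs xs↗ ok
                                 in es↗ , fits , leastFirst , ↭-reflexive concat≡
    ; unique   = dealLeast-unique
    ; avoids⇒arranged = λ τ avoid →
        guard123⇒leastFirst 0 (reverse τ) (Equivalence.to (avoids123⇔everyPair τ) avoid)
    ; arranged⇒avoids = λ τ υ↗ leastFirst →
        Equivalence.from (avoids123⇔everyPair τ) (leastFirst⇒guard123 0 (reverse τ) υ↗ leastFirst)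
    }

  greatestBelowDealing : Dealing
  greatestBelowDealing = record
    { avoided  = p213
    ; deal     = dealGreatestBelow
    ; CanDeal  = CanDealGreatestBelow
    ; Arranged = GreatestBelowFirst
    ; sound    = dealGreatestBelow-sound
    ; unique   = dealGreatestBelow-unique
    ; avoids⇒arranged = λ τ avoid →
        guard213⇒greatestBelowFirst 0 (reverse τ) (Equivalence.to (avoids213⇔everyPair τ) avoid)
    ; arranged⇒avoids = λ τ υ↗ greatestFirst →
        Equivalence.from (avoids213⇔everyPair τ) (greatestBelowFirst⇒guard213 0 (reverse τ) υ↗ greatestFirst)
    }

  transfer : Dealing → List (List (Fin m)) → List (List (Fin m))
  transfer D τ = reverse (glue (deal (sort (concat (lows 0 (reverse τ)))) (shape 0 (reverse τ))) (highs 0 (reverse τ)))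
    where open Dealing D

  Convert : Dealing → Dealing → Set
  Convert In Out = ∀ ρ xs → Nondecreasing ρ → Dealing.CanDeal In xs ρ → Dealing.CanDeal Out xs ρ

  module Switch (In Out : Dealing) (convert : Convert In Out)
    {τ : List (List (Fin m))} (τ↗ : All (Linked F._≤_) τ) (avoid : Avoids (Dealing.avoided In) τ) where

    private
      module I = Dealing In
      module O = Dealing Out

      υ : List (List (Fin m))
      υ = reverse τ

      υ↗ : All Ascending υ
      υ↗ = all-reverse τ (All.map linked⇒ascending τ↗)

      ρ : Shape
      ρ = shape 0 υ

      xs : List (Fin m)
      xs = sort (concat (lows 0 υ))

      xs↗ : Ascending xs
      xs↗ = ascending-sort _

      dealtIn : I.CanDeal xs ρ × I.deal xs ρ ≡ lows 0 υ
      dealtIn = I.unique ρ (lows 0 υ) (ascending-lows 0 υ υ↗) (I.avoids⇒arranged τ avoid) (fits-lows 0 υ) xs xs↗ (sort-↭ _)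

      es : List (List (Fin m))
      es = O.deal xs ρ

      dealtOut : All Ascending es × Fits es ρ × O.Arranged es ρ × concat es ↭ xs
      dealtOut = O.sound ρ xs xs↗ (convert ρ xs (shape-nondecreasing 0 υ) (proj₁ dealtIn))

      fits : Fits es ρ
      fits = proj₁ (proj₂ dealtOut)

      es↭ : concat es ↭ xs
      es↭ = proj₂ (proj₂ (proj₂ dealtOut))

      υ′ : List (List (Fin m))
      υ′ = glue es (highs 0 υ)

      υ′↗ : All Ascending υ′
      υ′↗ = ascending-glue 0 υ es υ↗ (proj₁ dealtOut) fits

      reverse-transfer : reverse (transfer Out τ) ≡ υ′
      reverse-transfer = Lₚ.reverse-involutive υ′

      lows≡ : lows 0 (reverse (transfer Out τ)) ≡ es
      lows≡ = trans (cong (lows 0) reverse-transfer) (proj₁ (decompose-glue 0 υ es fits))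

      highs≡ : highs 0 (reverse (transfer Out τ)) ≡ highs 0 υ
      highs≡ = trans (cong (highs 0) reverse-transfer) (proj₁ (proj₂ (decompose-glue 0 υ es fits)))

      shape≡ : shape 0 (reverse (transfer Out τ)) ≡ ρ
      shape≡ = trans (cong (shape 0) reverse-transfer) (proj₂ (proj₂ (decompose-glue 0 υ es fits)))

    transfer-linked : All (Linked F._≤_) (transfer Out τ)
    transfer-linked = all-reverse υ′ (All.map Linkedₚ.AllPairs⇒Linked υ′↗)

    transfer-map-length : map length (transfer Out τ) ≡ map length τ
    transfer-map-length = begin
      map length (reverse υ′)    ≡⟨ Lₚ.reverse-map length υ′ ⟩
      reverse (map length υ′)    ≡⟨ cong reverse (map-length-glue 0 υ es fits) ⟩
      reverse (map length υ)     ≡⟨ cong reverse (Lₚ.reverse-map length τ) ⟩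
      reverse (reverse (map length τ)) ≡⟨ Lₚ.reverse-involutive (map length τ) ⟩
      map length τ               ∎
      where open ≡-Reasoning

    transfer-↭ : concat (transfer Out τ) ↭ concat τ
    transfer-↭ = begin
      concat (reverse υ′)                     ↭⟨ concat-reverse-↭ υ′ ⟩
      concat υ′                               ↭⟨ concat-zipWith-++-↭ es (highs 0 υ) length-es ⟩
      concat es ++ concat (highs 0 υ)         ↭⟨ ++⁺ʳ _ (↭-trans es↭ (sort-↭ _)) ⟩
      concat (lows 0 υ) ++ concat (highs 0 υ) ↭⟨ concat-zipWith-++-↭ (lows 0 υ) (highs 0 υ) (trans (length-lows 0 υ) (sym (length-highs 0 υ))) ⟨
      concat (glue (lows 0 υ) (highs 0 υ))    ≡⟨ cong concat (glue-lows-highs 0 υ) ⟩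
      concat υ                                ↭⟨ concat-reverse-↭ τ ⟩
      concat τ                                ∎
      where
      open PermutationReasoning
      length-es : length es ≡ length (highs 0 υ)
      length-es = trans (length-Fits es ρ fits) (trans (length-shape 0 υ) (sym (length-highs 0 υ)))

    transfer-avoids : Avoids O.avoided (transfer Out τ)
    transfer-avoids = O.arranged⇒avoids (transfer Out τ) (subst (All Ascending) (sym reverse-transfer) υ′↗)
                        (subst₂ O.Arranged (sym lows≡) (sym shape≡) (proj₁ (proj₂ (proj₂ dealtOut))))

    transfer-inverse : transfer In (transfer Out τ) ≡ τ
    transfer-inverse = begin
      reverse (glue (I.deal (sort (concat (lows 0 (reverse (transfer Out τ))))) (shape 0 (reverse (transfer Out τ))))
                    (highs 0 (reverse (transfer Out τ))))
        ≡⟨ cong₂ (λ ys bs → reverse (glue ys bs)) (cong₂ I.deal sort≡ shape≡) highs≡ ⟩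
      reverse (glue (I.deal xs ρ) (highs 0 υ)) ≡⟨ cong (λ ys → reverse (glue ys (highs 0 υ))) (proj₂ dealtIn) ⟩
      reverse (glue (lows 0 υ) (highs 0 υ))   ≡⟨ cong reverse (glue-lows-highs 0 υ) ⟩
      reverse υ                               ≡⟨ Lₚ.reverse-involutive τ ⟩
      τ                                       ∎
      where
      open ≡-Reasoning
      sort≡ : sort (concat (lows 0 (reverse (transfer Out τ)))) ≡ xs
      sort≡ = trans (cong (sort ∘ concat) lows≡) (ascending-unique (ascending-sort _) xs↗ (↭-trans (sort-↭ _) es↭))

module Switching {α β : Composition} where
  open Blocks (length β)

  isGenPerm-transport : ∀ {τ τ′ : Array β} → map length τ′ ≡ map length τ → All (Linked F._≤_) τ′ →
                        concat τ′ ↭ concat τ → IsGenPerm α β τ → IsGenPerm α β τ′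
  isGenPerm-transport lengths≡ linked τ′↭τ (lengths , _ , counts) =
    trans lengths≡ lengths , linked , λ j → trans (↭-length (filter-↭ (F._≟ j) τ′↭τ)) (counts j)

  switch-valid : ∀ In Out → Convert In Out → ∀ {τ} → IsGenPerm α β τ × Avoids (Dealing.avoided In) τ →
                 IsGenPerm α β (transfer Out τ) × Avoids (Dealing.avoided Out) (transfer Out τ)
  switch-valid In Out convert (genPerm , avoid) =
    isGenPerm-transport transfer-map-length transfer-linked transfer-↭ genPerm , transfer-avoids
    where open Switch In Out convert (proj₁ (proj₂ genPerm)) avoid

  switch : ∀ In Out → Convert In Out → S α β (Dealing.avoided In) → S α β (Dealing.avoided Out)
  switch In Out convert (τ , [ p ]) = transfer Out τ , [ switch-valid In Out convert p ]

  -- Membership proofs are irrelevant, so the round trip on arrays is recovered through decidable equality.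
  switch-inverse : ∀ In Out (convert : Convert In Out) (convert⁻¹ : Convert Out In) σ →
                   switch Out In convert⁻¹ (switch In Out convert σ) ≡ σ
  switch-inverse In Out convert _ (τ , [ p ]) =
    value-injective (recompute (Lₚ.≡-dec (Lₚ.≡-dec F._≟_) _ τ)
      (Switch.transfer-inverse In Out convert (proj₁ (proj₂ (proj₁ p))) (proj₂ p)))


lemma2p4 : (N : ℕ) (α β : Composition) → IsCompositionOf N α → IsCompositionOf N β →
    S α β p213 ↔ S α β p123
-- The bijection exists for any α and β.
lemma2p4 N α β _ _ =
  mk↔ₛ′ (switch greatestBelowDealing leastDealing canDealGreatestBelow⇒canDealLeast)
        (switch leastDealing greatestBelowDealing canDealLeast⇒canDealGreatestBelow)
        (switch-inverse leastDealing greatestBelowDealing canDealLeast⇒canDealGreatestBelow canDealGreatestBelow⇒canDealLeast)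
        (switch-inverse greatestBelowDealing leastDealing canDealGreatestBelow⇒canDealLeast canDealLeast⇒canDealGreatestBelow)
  where
  open Blocks (length β)
  open Switching {α} {β}
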